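{- For $n\ge0$: $D(n,0)=1$, $\widetilde{D}(n,0)=0$, $D(n,n)=\frac{1+(-1)^n}{2}$, $\widetilde{D}(n,n)=\frac{1-(-1)^n}{2}$, and for $0<k<n$, \[D(n,k)=(2k+1)D(n-1,k)+(2n-2k+1)D(n-1,k-1)+\binom{n-1}{k-1}(-1)^k,\] \[\widetilde{D}(n,k)=(2k+1)\widetilde{D}(n-1,k)+(2n-2k+1)\widetilde{D}(n-1,k-1)-\binom{n-1}{k-1}(-1)^k.\]
   Context: $\mathcal{B}_n$ is the group of permutations $\sigma$ of $\{ -n,\dots,n\}$ with $\sigma(-k)=-\sigma(k)$ for all $k$. For $\sigma\in\mathcal{B}_n$, $\mathrm{desc}(\sigma)$ is the number of $i\in\{0,\dots,n-1\}$ with $\sigma(i)>\sigma(i+1)$ (descends of $(0,\sigma(1),\dots,\sigma(n))$). $\mathcal{D}_n$ is the set of $\sigma\in\mathcal{B}_n$ such that $\{\sigma(1),\dots,\sigma(n)\}$ contains an even number of negative elements, and $\widetilde{\mathcal{D}}_n=\mathcal{B}_n\setminus\mathcal{D}_n$. $D(n,k)=\#\{\sigma\in\mathcal{D}_n:\mathrm{desc}(\sigma)=k\}$ and $\widetilde{D}(n,k)=\#\{\sigma\in\widetilde{\mathcal{D}}_n:\mathrm{desc}(\sigma)=k\}$. -}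

module Defs where

open import Data.Nat as ℕ using (ℕ; zero; suc)
open import Data.Integer as ℤ using (ℤ; +_; -_; _-_; ∣_∣)
open import Data.Bool using (Bool; true; false; not; _∧_; _∨_; if_then_else_)
open import Data.List using (List; []; _∷_; map; filter; length; upTo; concatMap)
open import Data.Bool.ListAction using (all; any)
open import Data.Vec as Vec using (Vec; []; _∷_; toList)
open import Relation.Nullary.Decidable using (⌊_⌋)

-- A signed permutation σ ∈ B_n is determined by (σ(1),…,σ(n)), encoded as a
-- vector of integers; σ(0) = 0 and σ(-k) = - σ(k) give the rest.

-- nth element of a list (default 0; only used within range)
nth : List ℤ → ℕ → ℤ
nth []       _       = + 0
nth (x ∷ xs) zero    = x
nth (x ∷ xs) (suc i) = nth xs i

ext : {n : ℕ} → Vec ℤ n → ℤ → ℤ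
ext v (+ zero)    = + 0
ext v (+ suc i)   = nth (toList v) i
ext v ℤ.-[1+ i ]  = - nth (toList v) i

range : ℕ → List ℤ
range n = map (λ i → + i - + n) (upTo (suc (2 ℕ.* n)))

allVecs : (n m : ℕ) → List (Vec ℤ m)
allVecs n zero    = [] ∷ []
allVecs n (suc m) = concatMap (λ x → map (x ∷_) (allVecs n m)) (range n)

_==_ : ℤ → ℤ → Bool
x == y = ⌊ x ℤ.≟ y ⌋

isSignedPerm : {n : ℕ} → Vec ℤ n → Bool
isSignedPerm {n} v =
  all (λ x → any (λ y → ext v x == y) (range n)) (range n)
  ∧ all (λ x → all (λ y → not (ext v x == ext v y) ∨ (x == y)) (range n)) (range n)
  ∧ all (λ y → any (λ x → ext v x == y) (range n)) (range n)

Bn : (n : ℕ) → List (Vec ℤ n)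
Bn n = filter (λ v → isSignedPerm v Data.Bool.≟ true) (allVecs n n)
  where import Data.Bool

-- desc(σ): number of i ∈ {0,…,n-1} with σ(i) > σ(i+1)
descList : List ℤ → ℕ
descList []           = 0
descList (x ∷ [])     = 0
descList (x ∷ y ∷ xs) = (if ⌊ y ℤ.<? x ⌋ then 1 else 0) ℕ.+ descList (y ∷ xs)

desc : {n : ℕ} → Vec ℤ n → ℕ
desc v = descList (+ 0 ∷ toList v)

negCount : {n : ℕ} → Vec ℤ n → ℕ
negCount v = length (filter (λ x → x ℤ.<? + 0) (toList v))

isEven : ℕ → Bool
isEven zero          = true
isEven (suc zero)    = false
isEven (suc (suc m)) = isEven m

D : ℕ → ℕ → ℕ
D n k = length (filter (λ v → (isEven (negCount v) ∧ ⌊ desc v ℕ.≟ k ⌋) Data.Bool.≟ true) (Bn n))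
  where import Data.Bool

D̃ : ℕ → ℕ → ℕ
D̃ n k = length (filter (λ v → (not (isEven (negCount v)) ∧ ⌊ desc v ℕ.≟ k ⌋) Data.Bool.≟ true) (Bn n))
  where import Data.Bool

module Submission where

-- Inserting the largest letter n into 0·w keeps its number d
--     of descents at d+1 places and raises it by one at the other n-1-d; the
--     smallest letter -n keeps it at d places and adds a negative letter
--     (Descents).  Summing over w gives a recurrence mixing the two parity
--     classes (Recurrence), which already yields G(n,0) and G(n,n).
--  3. Algebra.  By induction G true - G false = (-1)^k C(n,k); eliminating the
--     other class from the mixed recurrence with the absorption identity
--     (k+1) C(m,k+1) = (m-k) C(m,k) (Binomial) gives the recurrences of the paper.

open import Defs
open import Data.Nat as ℕ using (ℕ; zero; suc; _≤_; _<_; _∸_; z≤n; s≤s)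
import Data.Nat.Properties as ℕP
open import Data.Integer as ℤ using (ℤ; +_; -_; -[1+_]; ∣_∣)
import Data.Integer.Properties as ℤP
open import Data.Bool using (Bool; true; false; not; _∧_; _∨_; if_then_else_)
import Data.Bool.Properties as BoolP
open import Data.List using (List; []; _∷_; _++_; map; filter; length; concatMap; applyDownFrom)
import Data.List.Properties as ListP
open import Data.List.Relation.Unary.Any using (Any; here; there)
open import Data.List.Relation.Unary.All as All using (All; []; _∷_)
open import Data.List.Relation.Unary.AllPairs using (AllPairs; []; _∷_)
open import Data.List.Membership.Propositional using (_∈_)
open import Data.List.Membership.Propositional.Properties
  using (∈-map⁺; ∈-map⁻; ∈-++⁺ˡ; ∈-++⁺ʳ; ∈-++⁻)
open import Data.List.Relation.Unary.Unique.Propositional using (Unique)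
import Data.List.Relation.Unary.Unique.Propositional.Properties as UniqueP
open import Data.List.Relation.Binary.Permutation.Propositional using (_↭_; prep; swap; ↭-sym)
import Data.List.Relation.Binary.Permutation.Propositional as Perm
open import Data.Product using (Σ; ∃-syntax; _×_; _,_; proj₁; proj₂; uncurry)
open import Data.Sum using (_⊎_; inj₁; inj₂)
open import Data.Empty using (⊥; ⊥-elim)
open import Relation.Nullary using (¬_; Dec; yes; no)
open import Relation.Nullary.Decidable using (⌊_⌋)
open import Relation.Binary.PropositionalEquality hiding ([_])

module ListFacts where
  open import Data.List.Membership.Propositional.Properties using (∈-concat⁺′; ∈-concat⁻′)
  open import Data.List.Relation.Binary.BagAndSetEquality using (∼bag⇒↭)
  open import Data.List.Membership.Propositional.Properties.WithK using (unique∧set⇒bag)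
  open import Function.Bundles using (mk⇔)

  private variable
    A B : Set

  sameMembers⇒↭ : {xs ys : List A} → Unique xs → Unique ys →
                  (∀ {z} → z ∈ xs → z ∈ ys) → (∀ {z} → z ∈ ys → z ∈ xs) → xs ↭ ys
  sameMembers⇒↭ ux uy f g = ∼bag⇒↭ (unique∧set⇒bag ux uy (mk⇔ f g))

  ∈-concatMap⁺ : ∀ (f : A → List B) {xs x u} → x ∈ xs → u ∈ f x → u ∈ concatMap f xs
  ∈-concatMap⁺ f x∈ u∈ = ∈-concat⁺′ u∈ (∈-map⁺ f x∈)

  ∈-concatMap⁻ : ∀ (f : A → List B) {xs u} → u ∈ concatMap f xs → ∃[ x ] (x ∈ xs × u ∈ f x)
  ∈-concatMap⁻ f {xs} u∈ with ys , u∈ys , ys∈ ← ∈-concat⁻′ (map f xs) u∈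
                         with x , x∈ , refl ← ∈-map⁻ f ys∈ = x , x∈ , u∈ys

  concatMap-unique : ∀ (f : A → List B) {xs} → Unique xs → (∀ {x} → x ∈ xs → Unique (f x)) →
                     (∀ {x y u} → x ∈ xs → y ∈ xs → u ∈ f x → u ∈ f y → x ≡ y) →
                     Unique (concatMap f xs)
  concatMap-unique f {[]}     _          _  _   = []
  concatMap-unique f {x ∷ xs} (x∉ ∷ uxs) uf inj =
    UniqueP.++⁺ (uf (here refl))
                (concatMap-unique f uxs (λ y∈ → uf (there y∈)) (λ y∈ z∈ → inj (there y∈) (there z∈)))
                λ (u∈x , u∈rest) → separate u∈x u∈rest
    where
    separate : ∀ {u} → u ∈ f x → u ∈ concatMap f xs → ⊥
    separate u∈x u∈rest with y , y∈ , u∈y ← ∈-concatMap⁻ f u∈rest =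
      All.lookup x∉ y∈ (inj (here refl) (there y∈) u∈x u∈y)

module Counting where
  open import Data.Nat using (_+_; _*_)
  open import Data.Nat.Tactic.RingSolver using (solve-∀)
  open import Algebra.Properties.CommutativeSemigroup ℕP.+-commutativeSemigroup
    using (x∙yz≈y∙xz)

  private variable
    A B : Set

  [_] : Bool → ℕ
  [ b ] = if b then 1 else 0

  count : (A → Bool) → List A → ℕ
  count p []       = 0
  count p (x ∷ xs) = [ p x ] + count p xs

  sumOver : List A → (A → ℕ) → ℕ
  sumOver []       f = 0
  sumOver (x ∷ xs) f = f x + sumOver xs f

  count-++ : (p : A → Bool) (xs ys : List A) → count p (xs ++ ys) ≡ count p xs + count p ys
  count-++ p []       ys = refl
  count-++ p (x ∷ xs) ys =
    trans (cong (_+_ [ p x ]) (count-++ p xs ys)) (sym (ℕP.+-assoc [ p x ] _ _))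

  count-↭ : (p : A → Bool) {xs ys : List A} → xs ↭ ys → count p xs ≡ count p ys
  count-↭ p Perm.refl     = refl
  count-↭ p (prep x q)    = cong (_+_ [ p x ]) (count-↭ p q)
  count-↭ p (swap x y q)  =
    trans (x∙yz≈y∙xz [ p x ] [ p y ] _) (cong (λ c → [ p y ] + ([ p x ] + c)) (count-↭ p q))
  count-↭ p (Perm.trans q q′) = trans (count-↭ p q) (count-↭ p q′)

  count-cong : ∀ (xs : List A) {p q : A → Bool} → (∀ {x} → x ∈ xs → p x ≡ q x) → count p xs ≡ count q xs
  count-cong []       _   = refl
  count-cong (x ∷ xs) p≗q = cong₂ _+_ (cong [_] (p≗q (here refl))) (count-cong xs (λ x∈ → p≗q (there x∈)))

  count-none : ∀ (xs : List A) {p : A → Bool} → (∀ {x} → x ∈ xs → p x ≡ false) → count p xs ≡ 0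
  count-none []       _      = refl
  count-none (x ∷ xs) p≡false rewrite p≡false (here refl) = count-none xs (λ x∈ → p≡false (there x∈))

  count-map : (p : B → Bool) (f : A → B) (xs : List A) →
              count p (map f xs) ≡ count (λ x → p (f x)) xs
  count-map p f []       = refl
  count-map p f (x ∷ xs) = cong (_+_ [ p (f x) ]) (count-map p f xs)

  count-concatMap : (p : B → Bool) (f : A → List B) (xs : List A) →
                    count p (concatMap f xs) ≡ sumOver xs (λ x → count p (f x))
  count-concatMap p f []       = refl
  count-concatMap p f (x ∷ xs) =
    trans (count-++ p (f x) (concatMap f xs)) (cong (_+_ (count p (f x))) (count-concatMap p f xs))

  sumOver-cong : ∀ (xs : List A) {f g : A → ℕ} → (∀ {x} → x ∈ xs → f x ≡ g x) → sumOver xs f ≡ sumOver xs g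
  sumOver-cong []       _   = refl
  sumOver-cong (x ∷ xs) f≗g = cong₂ _+_ (f≗g (here refl)) (sumOver-cong xs (λ x∈ → f≗g (there x∈)))

  sumOver-+ : ∀ (xs : List A) (f g : A → ℕ) → sumOver xs (λ x → f x + g x) ≡ sumOver xs f + sumOver xs g
  sumOver-+ []       f g = refl
  sumOver-+ (x ∷ xs) f g = trans (cong (_+_ (f x + g x)) (sumOver-+ xs f g)) (interchange (f x) (g x) _ _)
    where interchange : ∀ a b c d → (a + b) + (c + d) ≡ (a + c) + (b + d)
          interchange = solve-∀

  sumOver-indicator : ∀ (xs : List A) (α : ℕ) (p : A → Bool) → sumOver xs (λ x → α * [ p x ]) ≡ α * count p xs
  sumOver-indicator []       α p = sym (ℕP.*-zeroʳ α)
  sumOver-indicator (x ∷ xs) α p =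
    trans (cong (_+_ (α * [ p x ])) (sumOver-indicator xs α p)) (sym (ℕP.*-distribˡ-+ α [ p x ] _))

  sumOver-indicators : ∀ (xs : List A) α β (p q : A → Bool) →
    sumOver xs (λ x → α * [ p x ] + β * [ q x ]) ≡ α * count p xs + β * count q xs
  sumOver-indicators xs α β p q =
    trans (sumOver-+ xs _ _) (cong₂ _+_ (sumOver-indicator xs α p) (sumOver-indicator xs β q))

  length-filter : {P : A → Set} (P? : ∀ x → Dec (P x)) (xs : List A) →
                  length (filter P? xs) ≡ count (λ x → ⌊ P? x ⌋) xs
  length-filter P? []       = refl
  length-filter P? (x ∷ xs) with P? x
  ... | yes _ = cong suc (length-filter P? xs)
  ... | no  _ = length-filter P? xs

module SignedWords where
  open ListFacts using (sameMembers⇒↭)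
  open import Data.List.Membership.Propositional.Properties using (∈-applyDownFrom⁺; ∈-applyDownFrom⁻)
  open import Data.List.Relation.Binary.Permutation.Propositional.Properties using (Any-resp-↭; ↭-length)
  open import Data.List.Relation.Binary.Permutation.Propositional using (↭⇒↭ₛ)
  open import Data.List.Relation.Binary.Permutation.Setoid.Properties (setoid ℕ) using (Unique-resp-↭)

  absValues : ℕ → List ℕ
  absValues n = applyDownFrom suc n

  -- w is the one-line notation (σ(1),…,σ(n)) of a signed permutation σ of [n]
  -- exactly when its absolute values are a rearrangement of 1, …, n.
  IsSignedWord : ℕ → List ℤ → Set
  IsSignedWord n w = map ∣_∣ w ↭ absValues n

  ∈-absValues⁺ : ∀ {n j} → 0 < j → j ≤ n → j ∈ absValues n
  ∈-absValues⁺ {j = suc i} _ i<n = ∈-applyDownFrom⁺ suc i<n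

  ∈-absValues⁻ : ∀ {n j} → j ∈ absValues n → 0 < j × j ≤ n
  ∈-absValues⁻ j∈ with i , i<n , refl ← ∈-applyDownFrom⁻ suc j∈ = s≤s z≤n , i<n

  absValues-unique : ∀ n → Unique (absValues n)
  absValues-unique n =
    UniqueP.applyDownFrom⁺₁ suc n (λ j<i _ e → ℕP.<⇒≢ j<i (sym (ℕP.suc-injective e)))

  signedWord⁺ : ∀ {n w} → Unique (map ∣_∣ w) → (∀ {x} → x ∈ w → 0 < ∣ x ∣ × ∣ x ∣ ≤ n) →
                (∀ {j} → 0 < j → j ≤ n → j ∈ map ∣_∣ w) → IsSignedWord n w
  signedWord⁺ {n} {w} distinct bounded covering =
    sameMembers⇒↭ distinct (absValues-unique n) inAbsValues (λ j∈ → uncurry covering (∈-absValues⁻ j∈))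
    where
    inAbsValues : ∀ {j} → j ∈ map ∣_∣ w → j ∈ absValues n
    inAbsValues j∈ with x , x∈ , refl ← ∈-map⁻ ∣_∣ j∈ = uncurry ∈-absValues⁺ (bounded x∈)

  signedWord-distinct : ∀ {n w} → IsSignedWord n w → Unique (map ∣_∣ w)
  signedWord-distinct {n} σ = Unique-resp-↭ (↭⇒↭ₛ (↭-sym σ)) (absValues-unique n)

  signedWord-bounded : ∀ {n w x} → IsSignedWord n w → x ∈ w → 0 < ∣ x ∣ × ∣ x ∣ ≤ n
  signedWord-bounded σ x∈ = ∈-absValues⁻ (Any-resp-↭ σ (∈-map⁺ ∣_∣ x∈))

  signedWord-covers : ∀ {n w j} → IsSignedWord n w → 0 < j → j ≤ n → j ∈ map ∣_∣ w
  signedWord-covers σ 0<j j≤n = Any-resp-↭ (↭-sym σ) (∈-absValues⁺ 0<j j≤n)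

  signedWord-length : ∀ {n w} → IsSignedWord n w → length w ≡ n
  signedWord-length {n} {w} σ =
    trans (sym (ListP.length-map ∣_∣ w)) (trans (↭-length σ) (ListP.length-applyDownFrom suc n))

module Decoding where
  open ListFacts using (∈-concatMap⁺; concatMap-unique)
  open SignedWords
  open import Data.Nat using (_+_; _*_)
  import Data.Bool as Bool
  open import Data.Bool using (T)
  open import Data.Bool.ListAction using (all; any)
  open import Data.Bool.Properties using (T-≡; T-∧; T-∨)
  open import Data.List.Relation.Unary.All.Properties using (all⁺; all⁻)
  import Data.List.Relation.Unary.Any as Any
  open import Data.List.Relation.Unary.Any.Properties using (any⁺; any⁻)
  import Data.List.Relation.Unary.AllPairs.Properties as AllPairsP
  open import Data.List.Membership.Propositional using (find; lose)
  open import Data.List.Membership.Propositional.Properties using (∈-upTo⁺; ∈-upTo⁻; ∈-filter⁺; ∈-filter⁻)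
  open import Data.Vec using (Vec; []; _∷_; toList; fromList)
  import Data.Vec.Properties as VecP
  open import Relation.Nullary.Decidable using (toWitness; fromWitness; toWitnessFalse)
  open import Relation.Binary.Definitions using (tri<; tri≈; tri>)
  open import Function.Bundles using (Equivalence)
  open Equivalence using (to; from)
  open import Algebra.Bundles using (AbelianGroup)

  ∈-range⁻ : ∀ {n z} → z ∈ range n → ∣ z ∣ ≤ n
  ∈-range⁻ {n} z∈ with i , i∈ , refl ← ∈-map⁻ (λ i → + i ℤ.- + n) z∈ = bound i (∈-upTo⁻ i∈)
    where
    bound : ∀ i → i < suc (2 * n) → ∣ + i ℤ.- + n ∣ ≤ n
    bound i (s≤s i≤2n) rewrite ℤP.[+m]-[+n]≡m⊖n i n with ℕP.≤-<-connex n i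
    ... | inj₁ n≤i rewrite ℤP.⊖-≥ n≤i =
      ℕP.≤-trans (ℕP.∸-monoˡ-≤ n (subst (i ≤_) (cong (_+_ n) (ℕP.+-identityʳ n)) i≤2n))
                 (ℕP.≤-reflexive (ℕP.m+n∸n≡m n n))
    ... | inj₂ i<n rewrite ℤP.⊖-< i<n | ℤP.∣-i∣≡∣i∣ (+ (n ∸ i)) = ℕP.m∸n≤m n i

  ∈-range⁺ : ∀ {n z} → ∣ z ∣ ≤ n → z ∈ range n
  ∈-range⁺ {n} {z} ∣z∣≤n = subst (_∈ range n) (shift z ∣z∣≤n) (∈-map⁺ (λ i → + i ℤ.- + n) (∈-upTo⁺ (index< z ∣z∣≤n)))
    where
    index : ℤ → ℕ
    index (+ k)     = k + n
    index -[1+ k ]  = n ∸ suc k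
    index< : ∀ z → ∣ z ∣ ≤ n → index z < suc (2 * n)
    index< (+ k) k≤n = s≤s (subst (k + n ≤_) (cong (_+_ n) (sym (ℕP.+-identityʳ n))) (ℕP.+-monoˡ-≤ n k≤n))
    index< -[1+ k ] _ = s≤s (ℕP.≤-trans (ℕP.m∸n≤m n (suc k)) (ℕP.m≤m+n n (n + 0)))
    shift : ∀ z → ∣ z ∣ ≤ n → + index z ℤ.- + n ≡ z
    shift (+ k) _ =
      trans (ℤP.[+m]-[+n]≡m⊖n (k + n) n) (trans (ℤP.⊖-≥ (ℕP.m≤n+m n k)) (cong +_ (ℕP.m+n∸n≡m k n)))
    shift -[1+ k ] k<n =
      trans (ℤP.[+m]-[+n]≡m⊖n (n ∸ suc k) n)
        (trans (ℤP.⊖-< (ℕP.∸-monoʳ-< (s≤s z≤n) k<n)) (cong (λ t → - (+ t)) (ℕP.m∸[m∸n]≡n k<n)))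

  +suc∈range : ∀ {n i} → i < n → + suc i ∈ range n
  +suc∈range {n} = ∈-range⁺ {n}

  -[1+]∈range : ∀ {n i} → i < n → -[1+ i ] ∈ range n
  -[1+]∈range {n} = ∈-range⁺ {n}

  0∈range : ∀ {n} → + 0 ∈ range n
  0∈range {n} = ∈-range⁺ {n} {+ 0} z≤n

  range-unique : ∀ n → Unique (range n)
  range-unique n = UniqueP.map⁺ (λ e → ℤP.+-injective (∙-cancelʳ (- + n) _ _ e)) (UniqueP.upTo⁺ _)
    where open import Algebra.Properties.Group (AbelianGroup.group ℤP.+-0-abelianGroup) using (∙-cancelʳ)

  ==⇒≡ : ∀ {x y} → T (x == y) → x ≡ y
  ==⇒≡ {x} {y} = toWitness {a? = x ℤ.≟ y}

  ≡⇒== : ∀ {x y} → x ≡ y → T (x == y)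
  ≡⇒== {x} {y} = fromWitness {a? = x ℤ.≟ y}

  record ExtendsToPerm {n : ℕ} (v : Vec ℤ n) : Set where
    field
      into      : ∀ {x} → x ∈ range n → ext v x ∈ range n
      injective : ∀ {x y} → x ∈ range n → y ∈ range n → ext v x ≡ ext v y → x ≡ y
      onto      : ∀ {y} → y ∈ range n → Any (λ x → ext v x ≡ y) (range n)

  module _ {n : ℕ} (v : Vec ℤ n) where
    private
      intoTest ontoTest : ℤ → Bool
      intoTest x = any (λ y → ext v x == y) (range n)
      ontoTest y = any (λ x → ext v x == y) (range n)
      injTest : ℤ → ℤ → Bool
      injTest x y = not (ext v x == ext v y) ∨ (x == y)

    isSignedPerm⁻ : isSignedPerm v ≡ true → ExtendsToPerm v
    isSignedPerm⁻ sp = record { into = into ; injective = injective ; onto = onto }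
      where
      intoT : T (all intoTest (range n))
      intoT = proj₁ (to (T-∧ {all intoTest (range n)}) (from T-≡ sp))
      injOntoT : T (all (λ x → all (injTest x) (range n)) (range n)) × T (all ontoTest (range n))
      injOntoT = to (T-∧ {all (λ x → all (injTest x) (range n)) (range n)})
                    (proj₂ (to (T-∧ {all intoTest (range n)}) (from T-≡ sp)))
      into : ∀ {x} → x ∈ range n → ext v x ∈ range n
      into {x} x∈ =
        Any.map ==⇒≡ (any⁻ _ (range n) (All.lookup (all⁺ intoTest (range n) intoT) x∈))
      injective : ∀ {x y} → x ∈ range n → y ∈ range n → ext v x ≡ ext v y → x ≡ y
      injective {x} {y} x∈ y∈ e
        with to T-∨ (All.lookup (all⁺ (injTest x) (range n)
               (All.lookup (all⁺ (λ x → all (injTest x) (range n)) (range n) (proj₁ injOntoT)) x∈)) y∈)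
      ... | inj₁ distinctImages = ⊥-elim (toWitnessFalse {a? = ext v x ℤ.≟ ext v y} distinctImages e)
      ... | inj₂ sameArgs       = ==⇒≡ sameArgs
      onto : ∀ {y} → y ∈ range n → Any (λ x → ext v x ≡ y) (range n)
      onto {y} y∈ =
        Any.map ==⇒≡ (any⁻ _ (range n) (All.lookup (all⁺ ontoTest (range n) (proj₂ injOntoT)) y∈))

    isSignedPerm⁺ : ExtendsToPerm v → isSignedPerm v ≡ true
    isSignedPerm⁺ σ = to T-≡ (from T-∧ (intoOK , from T-∧ (injOK , ontoOK)))
      where
      open ExtendsToPerm σ
      injAt : ∀ {x y} → x ∈ range n → y ∈ range n → T (injTest x y)
      injAt {x} {y} x∈ y∈ with ext v x ℤ.≟ ext v y
      ... | yes e = ≡⇒== (injective x∈ y∈ e)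
      ... | no _  = _
      intoOK : T (all intoTest (range n))
      intoOK = all⁻ intoTest (All.tabulate (λ x∈ → any⁺ _ (Any.map ≡⇒== (into x∈))))
      injOK : T (all (λ x → all (injTest x) (range n)) (range n))
      injOK = all⁻ (λ x → all (injTest x) (range n))
                   (All.tabulate (λ {x} x∈ → all⁻ (injTest x) (All.tabulate (injAt x∈))))
      ontoOK : T (all ontoTest (range n))
      ontoOK = all⁻ ontoTest (All.tabulate (λ y∈ → any⁺ _ (Any.map ≡⇒== (onto y∈))))

  ∣∣-cases : ∀ {x y} → ∣ x ∣ ≡ ∣ y ∣ → x ≡ y ⊎ x ≡ - y
  ∣∣-cases {+ m}      {+ m}      refl = inj₁ refl
  ∣∣-cases {+ _}      { -[1+ _ ]} refl = inj₂ refl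
  ∣∣-cases { -[1+ _ ]} {+ _}      refl = inj₂ refl
  ∣∣-cases { -[1+ m ]} { -[1+ m ]} refl = inj₁ refl

  nth-∈ : ∀ {xs i} → i < length xs → nth xs i ∈ xs
  nth-∈ {_ ∷ _} {zero}  _         = here refl
  nth-∈ {_ ∷ _} {suc i} (s≤s i<) = there (nth-∈ i<)

  ∈⇒nth : ∀ {xs x} → x ∈ xs → ∃[ i ] (i < length xs × nth xs i ≡ x)
  ∈⇒nth (here refl) = 0 , s≤s z≤n , refl
  ∈⇒nth (there x∈) with i , i< , e ← ∈⇒nth x∈ = suc i , s≤s i< , e

  allPairs⇒nth : ∀ {R : ℤ → ℤ → Set} {xs} → AllPairs R xs →
                 ∀ {i j} → i < j → j < length xs → R (nth xs i) (nth xs j)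
  allPairs⇒nth {xs = _ ∷ _} (r ∷ _)  {zero}  {suc j} _       (s≤s j<) = All.lookup r (nth-∈ j<)
  allPairs⇒nth {xs = _ ∷ _} (_ ∷ rs) {suc i} {suc j} (s≤s i<j) (s≤s j<) = allPairs⇒nth rs i<j j<

  nth⇒allPairs : ∀ {R : ℤ → ℤ → Set} {xs} → (∀ {i j} → i < j → j < length xs → R (nth xs i) (nth xs j)) →
                 AllPairs R xs
  nth⇒allPairs {xs = []}     _ = []
  nth⇒allPairs {R = R} {x ∷ xs} r = All.tabulate first ∷ nth⇒allPairs (λ i<j j< → r (s≤s i<j) (s≤s j<))
    where
    first : ∀ {y} → y ∈ xs → R x y
    first y∈ with j , j< , refl ← ∈⇒nth y∈ = r (s≤s z≤n) (s≤s j<)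

  module FromPerm {n : ℕ} (v : Vec ℤ n) (σ : ExtendsToPerm v) where
    open ExtendsToPerm σ
    xs : List ℤ
    xs = toList v
    nth< : ∀ {i} → i < length xs → i < n
    nth< = subst (_ <_) (VecP.length-toList v)
    <len : ∀ {i} → i < n → i < length xs
    <len = subst (_ <_) (sym (VecP.length-toList v))

    -- Each entry σ(i+1) is a nonzero element of [-n, n], since σ(0) = 0.
    entry-bounded : ∀ {i} → i < n → 0 < ∣ nth xs i ∣ × ∣ nth xs i ∣ ≤ n
    entry-bounded {i} i<n = nonzero , ∈-range⁻ (into (+suc∈range i<n))
      where
      nonzero : 0 < ∣ nth xs i ∣
      nonzero with ∣ nth xs i ∣ in eq
      ... | suc _ = s≤s z≤n
      ... | zero with () ← injective (+suc∈range i<n) (0∈range {n}) (ℤP.∣i∣≡0⇒i≡0 eq)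

    -- The three hypotheses of signedWord⁺; distinctness and covering come from
    -- injectivity and surjectivity of σ, using σ(-x) = -σ(x).
    bounded : ∀ {x} → x ∈ xs → 0 < ∣ x ∣ × ∣ x ∣ ≤ n
    bounded x∈ with i , i< , refl ← ∈⇒nth x∈ = entry-bounded (nth< i<)

    distinct : Unique (map ∣_∣ xs)
    distinct = AllPairsP.map⁺ (nth⇒allPairs apart)
      where
      apart : ∀ {i j} → i < j → j < length xs → ∣ nth xs i ∣ ≢ ∣ nth xs j ∣
      apart {i} {j} i<j j< e with ∣∣-cases e
      ... | inj₁ same     with refl ← injective (+suc∈range (nth< (ℕP.<-trans i<j j<)))
                                                 (+suc∈range (nth< j<)) same = ℕP.<-irrefl refl i<j
      ... | inj₂ opposite with () ← injective (+suc∈range (nth< (ℕP.<-trans i<j j<)))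
                                              (-[1+]∈range (nth< j<)) opposite

    covering : ∀ {j} → 0 < j → j ≤ n → j ∈ map ∣_∣ xs
    covering {j} 0<j j≤n with find (onto (∈-range⁺ {n} {+ j} j≤n))
    ... | + zero    , _  , refl = ⊥-elim (ℕP.<-irrefl refl 0<j)
    ... | + suc i   , x∈ , e    = subst (_∈ map ∣_∣ xs) (cong ∣_∣ e)
                                        (∈-map⁺ ∣_∣ (nth-∈ (<len (∈-range⁻ x∈))))
    ... | -[1+ i ]  , x∈ , e    = subst (_∈ map ∣_∣ xs) (trans (sym (ℤP.∣-i∣≡∣i∣ (nth xs i))) (cong ∣_∣ e))
                                        (∈-map⁺ ∣_∣ (nth-∈ (<len (∈-range⁻ x∈))))

    signedWord-of-perm : IsSignedWord n (toList v)
    signedWord-of-perm = signedWord⁺ distinct bounded covering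

  ext-neg : ∀ {n} (v : Vec ℤ n) x → ext v (- x) ≡ - ext v x
  ext-neg v (+ zero)  = refl
  ext-neg v (+ suc i) = refl
  ext-neg v -[1+ i ]  = sym (ℤP.neg-involutive _)

  self-neg⇒0 : ∀ {z} → z ≡ - z → z ≡ + 0
  self-neg⇒0 {+ zero}   _  = refl
  self-neg⇒0 {+ suc _}  ()
  self-neg⇒0 { -[1+ _ ]} ()

  module FromSignedWord {n : ℕ} (v : Vec ℤ n) (σ : IsSignedWord n (toList v)) where
    xs : List ℤ
    xs = toList v
    <len : ∀ {i} → i < n → i < length xs
    <len = subst (_ <_) (sym (VecP.length-toList v))

    entry-bounded : ∀ {i} → i < n → 0 < ∣ nth xs i ∣ × ∣ nth xs i ∣ ≤ n
    entry-bounded i<n = signedWord-bounded σ (nth-∈ (<len i<n))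

    apart : ∀ {i j} → i < j → j < length xs → ∣ nth xs i ∣ ≢ ∣ nth xs j ∣
    apart = allPairs⇒nth (AllPairsP.map⁻ (signedWord-distinct σ))

    absAt : ℕ → ℕ
    absAt zero    = 0
    absAt (suc i) = ∣ nth xs i ∣

    ∣ext∣ : ∀ x → ∣ ext v x ∣ ≡ absAt ∣ x ∣
    ∣ext∣ (+ zero)  = refl
    ∣ext∣ (+ suc i) = refl
    ∣ext∣ -[1+ i ]  = ℤP.∣-i∣≡∣i∣ (nth xs i)

    absAt-bounded : ∀ {a} → a ≤ n → absAt a ≤ n
    absAt-bounded {zero}  _   = z≤n
    absAt-bounded {suc i} i<n = proj₂ (entry-bounded i<n)

    absAt-injective : ∀ {a b} → a ≤ n → b ≤ n → absAt a ≡ absAt b → a ≡ b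
    absAt-injective {zero}  {zero}  _   _   _ = refl
    absAt-injective {zero}  {suc j} _   j<n e = ⊥-elim (ℕP.<⇒≢ (proj₁ (entry-bounded j<n)) e)
    absAt-injective {suc i} {zero}  i<n _   e = ⊥-elim (ℕP.<⇒≢ (proj₁ (entry-bounded i<n)) (sym e))
    absAt-injective {suc i} {suc j} i<n j<n e with ℕP.<-cmp i j
    ... | tri< i<j _ _ = ⊥-elim (apart i<j (<len j<n) e)
    ... | tri≈ _ i≡j _ = cong suc i≡j
    ... | tri> _ _ j<i = ⊥-elim (apart j<i (<len i<n) (sym e))

    into : ∀ {x} → x ∈ range n → ext v x ∈ range n
    into {x} x∈ = ∈-range⁺ (subst (_≤ n) (sym (∣ext∣ x)) (absAt-bounded (∈-range⁻ x∈)))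

    injective : ∀ {x y} → x ∈ range n → y ∈ range n → ext v x ≡ ext v y → x ≡ y
    injective {x} {y} x∈ y∈ e
      with ∣∣-cases (absAt-injective (∈-range⁻ x∈) (∈-range⁻ y∈)
                       (trans (sym (∣ext∣ x)) (trans (cong ∣_∣ e) (∣ext∣ y))))
    ... | inj₁ x≡y  = x≡y
    ... | inj₂ refl = trans (cong -_ y≡0) (sym y≡0)
      where
      image≡0 : ext v y ≡ + 0
      image≡0 = self-neg⇒0 (trans (sym e) (ext-neg v y))
      y≡0 : y ≡ + 0
      y≡0 = ℤP.∣i∣≡0⇒i≡0 (absAt-injective (∈-range⁻ y∈) z≤n (trans (sym (∣ext∣ y)) (cong ∣_∣ image≡0)))

    -- Every y ≠ 0 of [-n, n] is ± an entry of xs, hence the image of ± its position.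
    reach : ∀ {j} y → ∣ y ∣ ≡ suc j → y ∈ range n → Any (λ x → ext v x ≡ y) (range n)
    reach y ∣y∣≡ y∈
      with x , x∈ , e ← ∈-map⁻ ∣_∣ (signedWord-covers σ (s≤s z≤n) (subst (_≤ n) ∣y∣≡ (∈-range⁻ y∈)))
      with i , i< , refl ← ∈⇒nth x∈
      with ∣∣-cases (trans (sym e) (sym ∣y∣≡))
    ... | inj₁ x≡y  = lose (+suc∈range (subst (i <_) (VecP.length-toList v) i<)) x≡y
    ... | inj₂ x≡-y = lose (-[1+]∈range (subst (i <_) (VecP.length-toList v) i<))
                           (trans (cong -_ x≡-y) (ℤP.neg-involutive y))

    onto : ∀ {y} → y ∈ range n → Any (λ x → ext v x ≡ y) (range n)
    onto {+ zero}   _  = lose (0∈range {n}) refl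
    onto {+ suc j}  y∈ = reach (+ suc j) refl y∈
    onto { -[1+ j ]} y∈ = reach -[1+ j ] refl y∈

    perm-of-signedWord : ExtendsToPerm v
    perm-of-signedWord = record { into = into ; injective = injective ; onto = onto }

  allVecs-complete : ∀ n {m} (v : Vec ℤ m) → All (_∈ range n) (toList v) → v ∈ allVecs n m
  allVecs-complete n []               _          = here refl
  allVecs-complete n {suc m} (x ∷ v) (x∈ ∷ v∈) =
    ∈-concatMap⁺ (λ x → map (x ∷_) (allVecs n m)) x∈ (∈-map⁺ (x ∷_) (allVecs-complete n v v∈))

  allVecs-unique : ∀ n m → Unique (allVecs n m)
  allVecs-unique n zero    = [] ∷ []
  allVecs-unique n (suc m) =
    concatMap-unique (λ x → map (x ∷_) (allVecs n m)) (range-unique n)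
      (λ _ → UniqueP.map⁺ VecP.∷-injectiveʳ (allVecs-unique n m)) sameHead
    where
    sameHead : ∀ {x y u} → x ∈ range n → y ∈ range n →
               u ∈ map (x ∷_) (allVecs n m) → u ∈ map (y ∷_) (allVecs n m) → x ≡ y
    sameHead {x} {y} _ _ u∈x u∈y with _ , _ , refl ← ∈-map⁻ (x ∷_) u∈x
                                   with _ , _ , e    ← ∈-map⁻ (y ∷_) u∈y = VecP.∷-injectiveˡ e

  toList-injective : ∀ {m} {u v : Vec ℤ m} → toList u ≡ toList v → u ≡ v
  toList-injective {u = u} {v} e = trans (sym (VecP.cast-is-id refl u)) (VecP.toList-injective refl u v e)

  BnWords : ℕ → List (List ℤ)
  BnWords n = map toList (Bn n)

  BnWords-unique : ∀ n → Unique (BnWords n)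
  BnWords-unique n = UniqueP.map⁺ toList-injective
                       (UniqueP.filter⁺ (λ v → isSignedPerm v Bool.≟ true) (allVecs-unique n n))

  ∈-BnWords⁻ : ∀ {n w} → w ∈ BnWords n → IsSignedWord n w
  ∈-BnWords⁻ {n} w∈ with v , v∈ , refl ← ∈-map⁻ toList w∈ =
    FromPerm.signedWord-of-perm v (isSignedPerm⁻ v (proj₂ (∈-filter⁻ (λ v → isSignedPerm v Bool.≟ true) {xs = allVecs n n} v∈)))

  ∈-BnWords⁺ : ∀ {n w} → IsSignedWord n w → w ∈ BnWords n
  ∈-BnWords⁺ {w = w} σ with refl ← signedWord-length σ =
    subst (_∈ BnWords (length w)) (VecP.toList∘fromList w) (∈-map⁺ toList v∈Bn)
    where
    v : Vec ℤ (length w)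
    v = fromList w
    σ′ : IsSignedWord (length w) (toList v)
    σ′ = subst (IsSignedWord (length w)) (sym (VecP.toList∘fromList w)) σ
    v∈Bn : v ∈ Bn (length w)
    v∈Bn = ∈-filter⁺ (λ v → isSignedPerm v Bool.≟ true)
             (allVecs-complete (length w) v
                (All.tabulate (λ x∈ → ∈-range⁺ (proj₂ (signedWord-bounded σ′ x∈)))))
             (isSignedPerm⁺ v (FromSignedWord.perm-of-signedWord v σ′))

module Insertion where
  open SignedWords
  open ListFacts
  open Decoding using (∣∣-cases)
  open import Data.List.Membership.Propositional.Properties using (∈-∃++)
  import Data.List.Relation.Unary.All.Properties as AllP
  open import Data.List.Relation.Binary.Permutation.Propositional.Properties
    using (shift; drop-∷; ↭-empty-inv)
    renaming (map⁺ to ↭-map⁺)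

  insertions : ℤ → List ℤ → List (List ℤ)
  insertions a []       = (a ∷ []) ∷ []
  insertions a (y ∷ ys) = (a ∷ y ∷ ys) ∷ map (y ∷_) (insertions a ys)

  ∈-insertions⁻ : ∀ {a w u} → u ∈ insertions a w →
                  Σ (List ℤ) λ ys → Σ (List ℤ) λ zs → w ≡ ys ++ zs × u ≡ ys ++ a ∷ zs
  ∈-insertions⁻ {w = []}    (here refl) = [] , [] , refl , refl
  ∈-insertions⁻ {w = y ∷ w} (here refl) = [] , y ∷ w , refl , refl
  ∈-insertions⁻ {w = y ∷ w} (there u∈)
    with u′ , u′∈ , refl ← ∈-map⁻ (y ∷_) u∈
    with ys , zs , refl , refl ← ∈-insertions⁻ u′∈ = y ∷ ys , zs , refl , refl

  ∈-insertions⁺ : ∀ {a} ys zs → ys ++ a ∷ zs ∈ insertions a (ys ++ zs)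
  ∈-insertions⁺ []       []       = here refl
  ∈-insertions⁺ []       (_ ∷ _)  = here refl
  ∈-insertions⁺ (y ∷ ys) zs       = there (∈-map⁺ (y ∷_) (∈-insertions⁺ ys zs))

  insertions-unique : ∀ {a w} → All (a ≢_) w → Unique (insertions a w)
  insertions-unique {w = []}    _          = [] ∷ []
  insertions-unique {a} {y ∷ w} (a≢y ∷ a∉) =
    All.tabulate atFront ∷ UniqueP.map⁺ ListP.∷-injectiveʳ (insertions-unique a∉)
    where
    atFront : ∀ {u} → u ∈ map (y ∷_) (insertions a w) → a ∷ y ∷ w ≢ u
    atFront u∈ e with _ , _ , refl ← ∈-map⁻ (y ∷_) u∈ = a≢y (ListP.∷-injectiveˡ e)

  split-unique : ∀ {P : ℤ → Set} {a a′} ys ys′ {zs zs′} →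
                 All (λ y → ¬ P y) ys → All (λ y → ¬ P y) ys′ → P a → P a′ →
                 ys ++ a ∷ zs ≡ ys′ ++ a′ ∷ zs′ → ys ≡ ys′ × a ≡ a′ × zs ≡ zs′
  split-unique []       []        _          _          _  _   e = refl , ListP.∷-injectiveˡ e , ListP.∷-injectiveʳ e
  split-unique []       (_ ∷ _)   _          (¬Py′ ∷ _) Pa _   e = ⊥-elim (¬Py′ (subst _ (ListP.∷-injectiveˡ e) Pa))
  split-unique (_ ∷ _)  []        (¬Py ∷ _)  _          _  Pa′ e = ⊥-elim (¬Py (subst _ (sym (ListP.∷-injectiveˡ e)) Pa′))
  split-unique (y ∷ ys) (y′ ∷ ys′) (_ ∷ ¬Pys) (_ ∷ ¬Pys′) Pa Pa′ e
    with refl ← ListP.∷-injectiveˡ e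
    with refl , rest ← split-unique ys ys′ ¬Pys ¬Pys′ Pa Pa′ (ListP.∷-injectiveʳ e) = refl , rest

  extensions : ℕ → List ℤ → List (List ℤ)
  extensions m w = insertions (+ suc m) w ++ insertions -[1+ m ] w

  ∈-extensions⁻ : ∀ {m w u} → u ∈ extensions m w →
                  Σ ℤ λ a → Σ (List ℤ) λ ys → Σ (List ℤ) λ zs →
                  ∣ a ∣ ≡ suc m × w ≡ ys ++ zs × u ≡ ys ++ a ∷ zs
  ∈-extensions⁻ {m} {w} u∈ with ∈-++⁻ (insertions (+ suc m) w) u∈
  ... | inj₁ u∈+ with ys , zs , e , e′ ← ∈-insertions⁻ u∈+ = + suc m , ys , zs , refl , e , e′
  ... | inj₂ u∈- with ys , zs , e , e′ ← ∈-insertions⁻ u∈- = -[1+ m ] , ys , zs , refl , e , e′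

  signedWords : ℕ → List (List ℤ)
  signedWords zero    = [] ∷ []
  signedWords (suc m) = concatMap (extensions m) (signedWords m)

  ∣∣-shift : ∀ a ys zs → map ∣_∣ (ys ++ a ∷ zs) ↭ ∣ a ∣ ∷ map ∣_∣ (ys ++ zs)
  ∣∣-shift a ys zs = ↭-map⁺ ∣_∣ (shift a ys zs)

  insert-signedWord : ∀ {m a} ys zs → ∣ a ∣ ≡ suc m →
                      IsSignedWord m (ys ++ zs) → IsSignedWord (suc m) (ys ++ a ∷ zs)
  insert-signedWord {m} {a} ys zs ∣a∣≡ σ =
    Perm.trans (∣∣-shift a ys zs) (subst (λ k → k ∷ map ∣_∣ (ys ++ zs) ↭ absValues (suc m)) (sym ∣a∣≡) (prep (suc m) σ))

  delete-signedWord : ∀ {m a} ys zs → ∣ a ∣ ≡ suc m →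
                      IsSignedWord (suc m) (ys ++ a ∷ zs) → IsSignedWord m (ys ++ zs)
  delete-signedWord {m} {a} ys zs ∣a∣≡ σ =
    drop-∷ (subst (λ k → k ∷ map ∣_∣ (ys ++ zs) ↭ absValues (suc m)) ∣a∣≡ (Perm.trans (↭-sym (∣∣-shift a ys zs)) σ))

  below : ∀ {m w} → IsSignedWord m w → All (λ y → ∣ y ∣ ≢ suc m) w
  below σ = All.tabulate λ y∈ e → ℕP.1+n≰n (subst (_≤ _) e (proj₂ (signedWord-bounded σ y∈)))

  ∈-signedWords⁻ : ∀ n {u} → u ∈ signedWords n → IsSignedWord n u
  ∈-signedWords⁻ zero    (here refl) = Perm.refl
  ∈-signedWords⁻ (suc m) u∈
    with w , w∈ , u∈w ← ∈-concatMap⁻ (extensions m) u∈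
    with a , ys , zs , ∣a∣≡ , refl , refl ← ∈-extensions⁻ {m} {w} u∈w =
    insert-signedWord ys zs ∣a∣≡ (∈-signedWords⁻ m w∈)

  ∈-signedWords⁺ : ∀ n {u} → IsSignedWord n u → u ∈ signedWords n
  ∈-signedWords⁺ zero    {u} σ with ↭-empty-inv σ
  ∈-signedWords⁺ zero    {[]} σ | refl = here refl
  ∈-signedWords⁺ (suc m) {u} σ
    with a , a∈ , m+1≡∣a∣ ← ∈-map⁻ ∣_∣ (signedWord-covers σ (s≤s z≤n) ℕP.≤-refl)
    with ys , zs , refl ← ∈-∃++ a∈ =
    ∈-concatMap⁺ (extensions m) (∈-signedWords⁺ m (delete-signedWord ys zs (sym m+1≡∣a∣) σ)) new
    where
    new : ys ++ a ∷ zs ∈ extensions m (ys ++ zs)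
    new with ∣∣-cases {a} {+ suc m} (sym m+1≡∣a∣)
    ... | inj₁ refl = ∈-++⁺ˡ (∈-insertions⁺ ys zs)
    ... | inj₂ refl = ∈-++⁺ʳ (insertions (+ suc m) (ys ++ zs)) (∈-insertions⁺ ys zs)

  signedWords-unique : ∀ n → Unique (signedWords n)
  signedWords-unique zero    = [] ∷ []
  signedWords-unique (suc m) =
    concatMap-unique (extensions m) (signedWords-unique m) extensions-unique sameSource
    where
    freePrefix : ∀ {w} ys {zs} → w ≡ ys ++ zs → All (λ y → ∣ y ∣ ≢ suc m) w →
                   All (λ y → ∣ y ∣ ≢ suc m) ys
    freePrefix ys refl = AllP.++⁻ˡ ys

    extensions-unique : ∀ {w} → w ∈ signedWords m → Unique (extensions m w)
    extensions-unique {w} w∈ =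
      UniqueP.++⁺ (insertions-unique (fresh refl)) (insertions-unique (fresh refl))
                  λ (u∈+ , u∈-) → signsDiffer u∈+ u∈-
      where
      σ : IsSignedWord m w
      σ = ∈-signedWords⁻ m w∈
      fresh : ∀ {a} → ∣ a ∣ ≡ suc m → All (a ≢_) w
      fresh ∣a∣≡ = All.map (λ ∣y∣≢ a≡y → ∣y∣≢ (trans (cong ∣_∣ (sym a≡y)) ∣a∣≡)) (below σ)
      signsDiffer : ∀ {u} → u ∈ insertions (+ suc m) w → u ∈ insertions -[1+ m ] w → ⊥
      signsDiffer u∈+ u∈-
        with ys , zs , e , refl ← ∈-insertions⁻ u∈+
        with ys′ , zs′ , e′ , e″ ← ∈-insertions⁻ u∈-
        with _ , () , _ ← split-unique {P = λ y → ∣ y ∣ ≡ suc m} ys ys′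
                             (freePrefix ys e (below σ)) (freePrefix ys′ e′ (below σ)) refl refl e″

    sameSource : ∀ {w w′ u} → w ∈ signedWords m → w′ ∈ signedWords m →
                 u ∈ extensions m w → u ∈ extensions m w′ → w ≡ w′
    sameSource {w} {w′} w∈ w′∈ u∈ u∈′
      with _ , ys , zs , ∣a∣≡ , refl , refl ← ∈-extensions⁻ {m} {w} u∈
      with _ , ys′ , zs′ , ∣a′∣≡ , refl , e ← ∈-extensions⁻ {m} {w′} u∈′
      with refl , _ , refl ← split-unique {P = λ y → ∣ y ∣ ≡ suc m} ys ys′
                               (AllP.++⁻ˡ ys (below (∈-signedWords⁻ m w∈)))
                               (AllP.++⁻ˡ ys′ (below (∈-signedWords⁻ m w′∈))) ∣a∣≡ ∣a′∣≡ e = refl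

module Descents where
  open Counting
  open SignedWords
  open Insertion
  open import Data.Nat using (_+_; _*_)
  open import Data.Nat.Tactic.RingSolver using (solve-∀)
  open import Data.List.Relation.Binary.Permutation.Propositional.Properties using (shift)
  open ≡-Reasoning

  descent? : ℤ → ℤ → Bool
  descent? x y = ⌊ y ℤ.<? x ⌋

  descent-no : ∀ {x y} → x ℤ.< y → descent? x y ≡ false
  descent-no {x} {y} x<y with y ℤ.<? x
  ... | yes y<x = ⊥-elim (ℤP.<-asym x<y y<x)
  ... | no  _   = refl

  descent-yes : ∀ {x y} → y ℤ.< x → descent? x y ≡ true
  descent-yes {x} {y} y<x with y ℤ.<? x
  ... | yes _   = refl
  ... | no  y≮x = ⊥-elim (y≮x y<x)

  descList-bound : ∀ x w → descList (x ∷ w) ≤ length w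
  descList-bound x []      = z≤n
  descList-bound x (y ∷ w) with descent? x y
  ... | true  = s≤s (descList-bound y w)
  ... | false = ℕP.m≤n⇒m≤1+n (descList-bound y w)

  -- Inserting a letter larger than x and all of w into x·w keeps the number
  -- d of descents at d+1 places (inside a descent, or at the end) and raises
  -- it to d+1 at the remaining |w| - d places.  Inductively: inserting right after x creates a new descent, and
  -- the later insertions are those into y·ys, shifted by the descent x, y.
  insertMax-descents : ∀ (Q : ℕ → Bool) x a w → x ℤ.< a → All (ℤ._< a) w →
    count (λ u → Q (descList (x ∷ u))) (insertions a w)
    ≡ suc (descList (x ∷ w)) * [ Q (descList (x ∷ w)) ]
      + (length w ∸ descList (x ∷ w)) * [ Q (suc (descList (x ∷ w))) ]
  insertMax-descents Q x a [] x<a [] rewrite descent-no x<a = identity [ Q 0 ] [ Q 1 ]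
    where identity : ∀ X Y → X + 0 ≡ 1 * X + 0 * Y
          identity = solve-∀
  insertMax-descents Q x a (y ∷ ys) x<a (y<a ∷ ys<a) = begin
    [ Q (descList (x ∷ a ∷ y ∷ ys)) ] + count (λ u → Q (descList (x ∷ u))) (map (y ∷_) (insertions a ys))
      ≡⟨ cong₂ _+_ (cong (λ t → [ Q t ]) newDescent) (count-map _ (y ∷_) (insertions a ys)) ⟩
    [ Q (suc d) ] + count (λ u → Q ([ b ] + descList (y ∷ u))) (insertions a ys)
      ≡⟨ cong (_+_ [ Q (suc d) ]) (insertMax-descents (λ t → Q ([ b ] + t)) y a ys y<a ys<a) ⟩
    [ Q (suc d) ] + (suc d * [ Q ([ b ] + d) ] + (length ys ∸ d) * [ Q ([ b ] + suc d) ])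
      ≡⟨ step b (descList-bound y ys) ⟩
    suc ([ b ] + d) * [ Q ([ b ] + d) ] + (length (y ∷ ys) ∸ ([ b ] + d)) * [ Q (suc ([ b ] + d)) ] ∎
    where
    b : Bool
    b = descent? x y
    d : ℕ
    d = descList (y ∷ ys)
    newDescent : descList (x ∷ a ∷ y ∷ ys) ≡ suc d
    newDescent rewrite descent-no x<a | descent-yes y<a = refl
    step : ∀ b → d ≤ length ys →
      [ Q (suc d) ] + (suc d * [ Q ([ b ] + d) ] + (length ys ∸ d) * [ Q ([ b ] + suc d) ])
      ≡ suc ([ b ] + d) * [ Q ([ b ] + d) ] + (suc (length ys) ∸ ([ b ] + d)) * [ Q (suc ([ b ] + d)) ]
    step true  _   = identity [ Q (suc d) ] [ Q (suc (suc d)) ] d (length ys ∸ d)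
      where identity : ∀ X Y d r → X + (suc d * X + r * Y) ≡ suc (suc d) * X + r * Y
            identity = solve-∀
    step false d≤ rewrite ℕP.+-∸-assoc 1 d≤ = identity [ Q d ] [ Q (suc d) ] d (length ys ∸ d)
      where identity : ∀ X Y d r → Y + (suc d * X + r * Y) ≡ suc d * X + suc r * Y
            identity = solve-∀

  -- Inserting a letter smaller than x and all of w into x·w keeps the number
  -- d of descents exactly at the d places after a descent top, and raises it
  -- to d+1 at the remaining |w| + 1 - d places.
  insertMin-descents : ∀ (Q : ℕ → Bool) x a w → a ℤ.< x → All (a ℤ.<_) w →
    count (λ u → Q (descList (x ∷ u))) (insertions a w)
    ≡ descList (x ∷ w) * [ Q (descList (x ∷ w)) ]
      + (suc (length w) ∸ descList (x ∷ w)) * [ Q (suc (descList (x ∷ w))) ]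
  insertMin-descents Q x a [] a<x [] rewrite descent-yes a<x = identity [ Q 0 ] [ Q 1 ]
    where identity : ∀ X Y → Y + 0 ≡ 0 * X + 1 * Y
          identity = solve-∀
  insertMin-descents Q x a (y ∷ ys) a<x (a<y ∷ a<ys) = begin
    [ Q (descList (x ∷ a ∷ y ∷ ys)) ] + count (λ u → Q (descList (x ∷ u))) (map (y ∷_) (insertions a ys))
      ≡⟨ cong₂ _+_ (cong (λ t → [ Q t ]) newDescent) (count-map _ (y ∷_) (insertions a ys)) ⟩
    [ Q (suc d) ] + count (λ u → Q ([ b ] + descList (y ∷ u))) (insertions a ys)
      ≡⟨ cong (_+_ [ Q (suc d) ]) (insertMin-descents (λ t → Q ([ b ] + t)) y a ys a<y a<ys) ⟩
    [ Q (suc d) ] + (d * [ Q ([ b ] + d) ] + (suc (length ys) ∸ d) * [ Q ([ b ] + suc d) ])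
      ≡⟨ step b (ℕP.m≤n⇒m≤1+n (descList-bound y ys)) ⟩
    ([ b ] + d) * [ Q ([ b ] + d) ] + (suc (length (y ∷ ys)) ∸ ([ b ] + d)) * [ Q (suc ([ b ] + d)) ] ∎
    where
    b : Bool
    b = descent? x y
    d : ℕ
    d = descList (y ∷ ys)
    newDescent : descList (x ∷ a ∷ y ∷ ys) ≡ suc d
    newDescent rewrite descent-yes a<x | descent-no a<y = refl
    step : ∀ b → d ≤ suc (length ys) →
      [ Q (suc d) ] + (d * [ Q ([ b ] + d) ] + (suc (length ys) ∸ d) * [ Q ([ b ] + suc d) ])
      ≡ ([ b ] + d) * [ Q ([ b ] + d) ] + (suc (suc (length ys)) ∸ ([ b ] + d)) * [ Q (suc ([ b ] + d)) ]
    step true  _   = identity [ Q (suc d) ] [ Q (suc (suc d)) ] d (suc (length ys) ∸ d)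
      where identity : ∀ X Y d r → X + (d * X + r * Y) ≡ suc d * X + r * Y
            identity = solve-∀
    step false d≤ rewrite ℕP.+-∸-assoc 1 d≤ = identity [ Q d ] [ Q (suc d) ] d (suc (length ys) ∸ d)
      where identity : ∀ X Y d r → Y + (d * X + r * Y) ≡ d * X + suc r * Y
            identity = solve-∀

  -- Every insertion of a into w has the same letters as a ∷ w, hence the same counts.
  count-insertion : ∀ (p : ℤ → Bool) {a w u} → u ∈ insertions a w → count p u ≡ [ p a ] + count p w
  count-insertion p {a} u∈ with ys , zs , refl , refl ← ∈-insertions⁻ u∈ =
    count-↭ p (shift a ys zs)

  negatives : List ℤ → ℕ
  negatives = count (λ x → ⌊ x ℤ.<? + 0 ⌋)

  descents : List ℤ → ℕ
  descents w = descList (+ 0 ∷ w)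

  hasParity : Bool → ℕ → Bool
  hasParity true  c = isEven c
  hasParity false c = not (isEven c)

  hasParity-suc : ∀ b c → hasParity b (suc c) ≡ hasParity (not b) c
  hasParity-suc true  c = isEven-suc c
    where isEven-suc : ∀ c → isEven (suc c) ≡ not (isEven c)
          isEven-suc zero          = refl
          isEven-suc (suc zero)    = refl
          isEven-suc (suc (suc c)) = isEven-suc c
  hasParity-suc false c = trans (cong not (hasParity-suc true c)) (BoolP.not-involutive (isEven c))

  inClass : Bool → ℕ → List ℤ → Bool
  inClass b k w = hasParity b (negatives w) ∧ ⌊ descents w ℕ.≟ k ⌋

  indicator-at : ∀ c t k (f : ℕ → ℕ) → f t * [ c ∧ ⌊ t ℕ.≟ k ⌋ ] ≡ f k * [ c ∧ ⌊ t ℕ.≟ k ⌋ ]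
  indicator-at c t k f with t ℕ.≟ k
  ... | yes refl = refl
  ... | no  _    rewrite BoolP.∧-zeroʳ c = trans (ℕP.*-zeroʳ (f t)) (sym (ℕP.*-zeroʳ (f k)))

  ≟-suc : ∀ t k → ⌊ suc t ℕ.≟ suc k ⌋ ≡ ⌊ t ℕ.≟ k ⌋
  ≟-suc t k with t ℕ.≟ k | suc t ℕ.≟ suc k
  ... | yes _   | yes _     = refl
  ... | no  _   | no  _     = refl
  ... | yes t≡k | no  t≢k   = ⊥-elim (t≢k (cong suc t≡k))
  ... | no  t≢k | yes t≡k   = ⊥-elim (t≢k (ℕP.suc-injective t≡k))

  classAt : Bool → ℕ → List ℤ → ℕ → Bool
  classAt b k w t = hasParity b (negatives w) ∧ ⌊ t ℕ.≟ k ⌋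

  -- Count of a class over the extensions of a signed word w of [m] by ±(m+1):
  -- +(m+1) is a largest letter and keeps the negatives, -(m+1) is a smallest
  -- letter and adds one negative.
  count-extensions : ∀ b k m w → IsSignedWord m w →
    count (inClass b k) (extensions m w)
    ≡ (suc (descents w) * [ classAt b k w (descents w) ] + (m ∸ descents w) * [ classAt b k w (suc (descents w)) ])
      + (descents w * [ classAt (not b) k w (descents w) ]
         + (suc m ∸ descents w) * [ classAt (not b) k w (suc (descents w)) ])
  count-extensions b k m w σ with refl ← signedWord-length σ = begin
    count (inClass b k) (insertions (+ suc m) w ++ insertions -[1+ m ] w)
      ≡⟨ count-++ (inClass b k) (insertions (+ suc m) w) _ ⟩
    count (inClass b k) (insertions (+ suc m) w) + count (inClass b k) (insertions -[1+ m ] w)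
      ≡⟨ cong₂ _+_ (count-cong (insertions (+ suc m) w) keepsParity)
                   (count-cong (insertions -[1+ m ] w) flipsParity) ⟩
    count (λ u → classAt b k w (descents u)) (insertions (+ suc m) w)
      + count (λ u → classAt (not b) k w (descents u)) (insertions -[1+ m ] w)
      ≡⟨ cong₂ _+_ (insertMax-descents (classAt b k w) (+ 0) (+ suc m) w (ℤ.+<+ (s≤s z≤n)) (All.tabulate below-max))
                   (insertMin-descents (classAt (not b) k w) (+ 0) -[1+ m ] w ℤ.-<+ (All.tabulate above-min)) ⟩
    (suc (descents w) * [ classAt b k w (descents w) ] + (m ∸ descents w) * [ classAt b k w (suc (descents w)) ])
      + (descents w * [ classAt (not b) k w (descents w) ]
         + (suc m ∸ descents w) * [ classAt (not b) k w (suc (descents w)) ]) ∎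
    where
    keepsParity : ∀ {u} → u ∈ insertions (+ suc m) w → inClass b k u ≡ classAt b k w (descents u)
    keepsParity {u} u∈ = cong (λ c → hasParity b c ∧ ⌊ descents u ℕ.≟ k ⌋) (count-insertion _ u∈)
    flipsParity : ∀ {u} → u ∈ insertions -[1+ m ] w → inClass b k u ≡ classAt (not b) k w (descents u)
    flipsParity {u} u∈ = cong (λ c → c ∧ ⌊ descents u ℕ.≟ k ⌋)
                           (trans (cong (hasParity b) (count-insertion _ u∈)) (hasParity-suc b (negatives w)))
    below-max : ∀ {y} → y ∈ w → y ℤ.< + suc m
    below-max {+ _}      y∈ = ℤ.+<+ (s≤s (proj₂ (signedWord-bounded σ y∈)))
    below-max { -[1+ _ ]} _  = ℤ.-<+
    above-min : ∀ {y} → y ∈ w → -[1+ m ] ℤ.< y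
    above-min {+ _}      _  = ℤ.-<+
    above-min { -[1+ _ ]} y∈ = ℤ.-<- (proj₂ (signedWord-bounded σ y∈))

  -- Reading off the target number k = 0, resp. k = j + 1, of descents: only
  -- words with d = k or d + 1 = k contribute.
  count-extensions-zero : ∀ b m w → IsSignedWord m w →
    count (inClass b 0) (extensions m w) ≡ 1 * [ inClass b 0 w ]
  count-extensions-zero b m w σ = begin
    count (inClass b 0) (extensions m w)
      ≡⟨ count-extensions b 0 m w σ ⟩
    (suc d * [ classAt b 0 w d ] + (m ∸ d) * [ classAt b 0 w (suc d) ])
      + (d * [ classAt (not b) 0 w d ] + (suc m ∸ d) * [ classAt (not b) 0 w (suc d) ])
      ≡⟨ cong₂ _+_ (cong₂ _+_ (indicator-at (hasParity b (negatives w)) d 0 suc)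
                              (cong (λ i → (m ∸ d) * [ i ]) (BoolP.∧-zeroʳ (hasParity b (negatives w)))))
                   (cong₂ _+_ (indicator-at (hasParity (not b) (negatives w)) d 0 (λ t → t))
                              (cong (λ i → (suc m ∸ d) * [ i ]) (BoolP.∧-zeroʳ (hasParity (not b) (negatives w))))) ⟩
    (1 * [ inClass b 0 w ] + (m ∸ d) * 0) + (0 * [ classAt (not b) 0 w d ] + (suc m ∸ d) * 0)
      ≡⟨ identity (1 * [ inClass b 0 w ]) (m ∸ d) [ classAt (not b) 0 w d ] (suc m ∸ d) ⟩
    1 * [ inClass b 0 w ] ∎
    where
    d : ℕ
    d = descents w
    identity : ∀ x r y s → (x + r * 0) + (0 * y + s * 0) ≡ x
    identity = solve-∀

  count-extensions-suc : ∀ b j m w → IsSignedWord m w →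
    count (inClass b (suc j)) (extensions m w)
    ≡ (suc (suc j) * [ inClass b (suc j) w ] + (m ∸ j) * [ inClass b j w ])
      + (suc j * [ inClass (not b) (suc j) w ] + (suc m ∸ j) * [ inClass (not b) j w ])
  count-extensions-suc b j m w σ = begin
    count (inClass b (suc j)) (extensions m w)
      ≡⟨ count-extensions b (suc j) m w σ ⟩
    (suc d * [ classAt b (suc j) w d ] + (m ∸ d) * [ classAt b (suc j) w (suc d) ])
      + (d * [ classAt (not b) (suc j) w d ] + (suc m ∸ d) * [ classAt (not b) (suc j) w (suc d) ])
      ≡⟨ cong₂ _+_ (cong₂ _+_ (indicator-at (hasParity b (negatives w)) d (suc j) suc) (oneLess b (m ∸_)))
                   (cong₂ _+_ (indicator-at (hasParity (not b) (negatives w)) d (suc j) (λ t → t))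
                              (oneLess (not b) (suc m ∸_))) ⟩
    (suc (suc j) * [ inClass b (suc j) w ] + (m ∸ j) * [ inClass b j w ])
      + (suc j * [ inClass (not b) (suc j) w ] + (suc m ∸ j) * [ inClass (not b) j w ]) ∎
    where
    d : ℕ
    d = descents w
    oneLess : ∀ c (f : ℕ → ℕ) → f d * [ classAt c (suc j) w (suc d) ] ≡ f j * [ inClass c j w ]
    oneLess c f = trans (cong (λ i → f d * [ hasParity c (negatives w) ∧ i ]) (≟-suc d j))
                        (indicator-at (hasParity c (negatives w)) d j f)

module Recurrence where
  open Counting
  open SignedWords
  open Insertion
  open Descents
  open import Data.Nat using (_+_; _*_)
  open import Data.Nat.Tactic.RingSolver using (solve-∀)
  open ≡-Reasoning

  G : Bool → ℕ → ℕ → ℕ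
  G b n k = count (inClass b k) (signedWords n)

  G-suc : ∀ b m k → G b (suc m) k ≡ sumOver (signedWords m) (λ w → count (inClass b k) (extensions m w))
  G-suc b m k = count-concatMap (inClass b k) (extensions m) (signedWords m)

  G-recurrence-zero : ∀ b m → G b (suc m) 0 ≡ G b m 0
  G-recurrence-zero b m = begin
    G b (suc m) 0
      ≡⟨ G-suc b m 0 ⟩
    sumOver (signedWords m) (λ w → count (inClass b 0) (extensions m w))
      ≡⟨ sumOver-cong (signedWords m) (λ w∈ → count-extensions-zero b m _ (∈-signedWords⁻ m w∈)) ⟩
    sumOver (signedWords m) (λ w → 1 * [ inClass b 0 w ])
      ≡⟨ sumOver-indicator (signedWords m) 1 (inClass b 0) ⟩
    1 * G b m 0
      ≡⟨ ℕP.*-identityˡ (G b m 0) ⟩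
    G b m 0 ∎

  G-recurrence : ∀ b m j → G b (suc m) (suc j)
    ≡ (suc (suc j) * G b m (suc j) + (m ∸ j) * G b m j)
      + (suc j * G (not b) m (suc j) + (suc m ∸ j) * G (not b) m j)
  G-recurrence b m j = begin
    G b (suc m) (suc j)
      ≡⟨ G-suc b m (suc j) ⟩
    sumOver ws (λ w → count (inClass b (suc j)) (extensions m w))
      ≡⟨ sumOver-cong ws (λ w∈ → count-extensions-suc b j m _ (∈-signedWords⁻ m w∈)) ⟩
    sumOver ws (λ w → (suc (suc j) * [ inClass b (suc j) w ] + (m ∸ j) * [ inClass b j w ])
                      + (suc j * [ inClass (not b) (suc j) w ] + (suc m ∸ j) * [ inClass (not b) j w ]))
      ≡⟨ sumOver-+ ws _ _ ⟩
    sumOver ws (λ w → suc (suc j) * [ inClass b (suc j) w ] + (m ∸ j) * [ inClass b j w ])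
      + sumOver ws (λ w → suc j * [ inClass (not b) (suc j) w ] + (suc m ∸ j) * [ inClass (not b) j w ])
      ≡⟨ cong₂ _+_ (sumOver-indicators ws (suc (suc j)) (m ∸ j) (inClass b (suc j)) (inClass b j))
                   (sumOver-indicators ws (suc j) (suc m ∸ j) (inClass (not b) (suc j)) (inClass (not b) j)) ⟩
    (suc (suc j) * G b m (suc j) + (m ∸ j) * G b m j)
      + (suc j * G (not b) m (suc j) + (suc m ∸ j) * G (not b) m j) ∎
    where ws : List (List ℤ)
          ws = signedWords m

  -- A signed word of [m] has at most m descents.
  G-vanishes : ∀ b m k → m < k → G b m k ≡ 0
  G-vanishes b m k m<k = count-none (signedWords m) tooMany
    where
    tooMany : ∀ {w} → w ∈ signedWords m → inClass b k w ≡ false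
    tooMany {w} w∈ with descents w ℕ.≟ k
    ... | no  _ = BoolP.∧-zeroʳ (hasParity b (negatives w))
    ... | yes refl = ⊥-elim (ℕP.<⇒≱ m<k (subst (descents w ≤_) (signedWord-length (∈-signedWords⁻ m w∈))
                                                   (descList-bound (+ 0) w)))

  -- Only the identity has no descents, and it has no negative letters.
  G-zero : ∀ b n → G b n 0 ≡ [ b ]
  G-zero true  zero    = refl
  G-zero false zero    = refl
  G-zero b     (suc m) = trans (G-recurrence-zero b m) (G-zero b m)

  -- n descents force σ(i) = -i for all i, which has n negative letters.
  G-diagonal : ∀ b n → G b n n ≡ [ hasParity b n ]
  G-diagonal true  zero    = refl
  G-diagonal false zero    = refl
  G-diagonal b     (suc m) = begin
    G b (suc m) (suc m)
      ≡⟨ G-recurrence b m m ⟩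
    (suc (suc m) * G b m (suc m) + (m ∸ m) * G b m m) + (suc m * G (not b) m (suc m) + (suc m ∸ m) * G (not b) m m)
      ≡⟨ cong₂ (λ x y → (suc (suc m) * x + (m ∸ m) * G b m m) + (suc m * y + (suc m ∸ m) * G (not b) m m))
               (G-vanishes b m (suc m) (ℕP.n<1+n m)) (G-vanishes (not b) m (suc m) (ℕP.n<1+n m)) ⟩
    (suc (suc m) * 0 + (m ∸ m) * G b m m) + (suc m * 0 + (suc m ∸ m) * G (not b) m m)
      ≡⟨ cong₂ (λ x y → (suc (suc m) * 0 + x * G b m m) + (suc m * 0 + y * G (not b) m m))
               (ℕP.n∸n≡0 m) (trans (ℕP.+-∸-assoc 1 (ℕP.≤-refl {m})) (cong suc (ℕP.n∸n≡0 m))) ⟩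
    (suc (suc m) * 0 + 0 * G b m m) + (suc m * 0 + 1 * G (not b) m m)
      ≡⟨ identity (suc (suc m)) (suc m) (G b m m) (G (not b) m m) ⟩
    G (not b) m m
      ≡⟨ G-diagonal (not b) m ⟩
    [ hasParity (not b) m ]
      ≡⟨ cong [_] (sym (hasParity-suc b m)) ⟩
    [ hasParity b (suc m) ] ∎
    where identity : ∀ p q x y → (p * 0 + 0 * x) + (q * 0 + 1 * y) ≡ y
          identity = solve-∀

module Binomial where
  open import Data.Nat using (_+_; _*_)
  open import Data.Nat.Combinatorics using (_C_; nCk+nC[k+1]≡[n+1]C[k+1]; nC1≡n; k>n⇒nCk≡0)
  open import Data.Nat.Tactic.RingSolver using (solve-∀)
  open ≡-Reasoning

  -- (k+1) C(m,k+1) + k C(m,k) = m C(m,k): pairs (k-subset S, x ∈ [m]) with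
  -- x ∉ S are the (k+1)-subsets S ∪ {x} with a marked element, those with
  -- x ∈ S number k C(m,k).
  weighted-pascal : ∀ m k → suc k * (m C suc k) + k * (m C k) ≡ m * (m C k)
  weighted-pascal zero    zero    = refl
  weighted-pascal zero    (suc k) = cong₂ _+_ (ℕP.*-zeroʳ (suc (suc k))) (ℕP.*-zeroʳ (suc k))
  weighted-pascal (suc m) zero    =
    trans (ℕP.+-identityʳ _) (trans (ℕP.+-identityʳ _) (trans (nC1≡n (suc m)) (sym (ℕP.*-identityʳ (suc m)))))
  weighted-pascal (suc m) (suc k) = begin
    suc (suc k) * (suc m C suc (suc k)) + suc k * (suc m C suc k)
      ≡⟨ cong₂ (λ x y → suc (suc k) * x + suc k * y) (sym (pascal (suc k))) (sym (pascal k)) ⟩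
    suc (suc k) * (m C suc k + m C suc (suc k)) + suc k * (m C k + m C suc k)
      ≡⟨ regroup k (m C k) (m C suc k) (m C suc (suc k)) ⟩
    ((suc (suc k) * (m C suc (suc k)) + suc k * (m C suc k)) + (suc k * (m C suc k) + k * (m C k)))
      + m C suc k + m C k
      ≡⟨ cong (λ t → t + m C suc k + m C k) (cong₂ _+_ (weighted-pascal m (suc k)) (weighted-pascal m k)) ⟩
    m * (m C suc k) + m * (m C k) + m C suc k + m C k
      ≡⟨ collect m (m C k) (m C suc k) ⟩
    suc m * (m C k + m C suc k)
      ≡⟨ cong (suc m *_) (pascal k) ⟩
    suc m * (suc m C suc k) ∎
    where
    pascal : ∀ k → m C k + m C suc k ≡ suc m C suc k
    pascal = nCk+nC[k+1]≡[n+1]C[k+1] m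
    regroup : ∀ k c₀ c₁ c₂ → suc (suc k) * (c₁ + c₂) + suc k * (c₀ + c₁)
                             ≡ ((suc (suc k) * c₂ + suc k * c₁) + (suc k * c₁ + k * c₀)) + c₁ + c₀
    regroup = solve-∀
    collect : ∀ m c₀ c₁ → m * c₁ + m * c₀ + c₁ + c₀ ≡ suc m * (c₀ + c₁)
    collect = solve-∀

  absorption : ∀ m k → suc k * (m C suc k) ≡ (m ∸ k) * (m C k)
  absorption m k with ℕP.≤-<-connex k m
  ... | inj₁ k≤m = ℕP.+-cancelʳ-≡ (k * (m C k)) _ _ (begin
        suc k * (m C suc k) + k * (m C k)  ≡⟨ weighted-pascal m k ⟩
        m * (m C k)                         ≡⟨ cong (_* (m C k)) (sym (ℕP.m∸n+n≡m k≤m)) ⟩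
        (m ∸ k + k) * (m C k)               ≡⟨ ℕP.*-distribʳ-+ (m C k) (m ∸ k) k ⟩
        (m ∸ k) * (m C k) + k * (m C k)     ∎)
  ... | inj₂ m<k rewrite k>n⇒nCk≡0 m<k | k>n⇒nCk≡0 (ℕP.m<n⇒m<1+n m<k) =
        trans (ℕP.*-zeroʳ (suc k)) (sym (ℕP.*-zeroʳ (m ∸ k)))

module Enumeration where
  open Counting
  open ListFacts using (sameMembers⇒↭)
  open Decoding using (BnWords; BnWords-unique; ∈-BnWords⁻; ∈-BnWords⁺)
  open Insertion using (signedWords; signedWords-unique; ∈-signedWords⁻; ∈-signedWords⁺)
  open Descents using (hasParity; inClass)
  open Recurrence using (G)
  open import Data.Vec using (toList)
  import Data.Bool as Bool

  BnWords↭signedWords : ∀ n → BnWords n ↭ signedWords n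
  BnWords↭signedWords n =
    sameMembers⇒↭ (BnWords-unique n) (signedWords-unique n)
      (λ w∈ → ∈-signedWords⁺ n (∈-BnWords⁻ w∈)) (λ w∈ → ∈-BnWords⁺ (∈-signedWords⁻ n w∈))

  filterBn≡G : ∀ b n k →
    length (filter (λ v → (hasParity b (negCount v) ∧ ⌊ desc v ℕ.≟ k ⌋) Bool.≟ true) (Bn n)) ≡ G b n k
  filterBn≡G b n k = begin
    length (filter (λ v → (hasParity b (negCount v) ∧ ⌊ desc v ℕ.≟ k ⌋) Bool.≟ true) (Bn n))
      ≡⟨ length-filter _ (Bn n) ⟩
    count (λ v → ⌊ (hasParity b (negCount v) ∧ ⌊ desc v ℕ.≟ k ⌋) Bool.≟ true ⌋) (Bn n)
      ≡⟨ count-cong (Bn n) (λ {v} _ → trans (isTrue _) (cong (λ c → hasParity b c ∧ ⌊ desc v ℕ.≟ k ⌋)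
                                                              (length-filter _ (toList v)))) ⟩
    count (λ v → inClass b k (toList v)) (Bn n)
      ≡⟨ sym (count-map (inClass b k) toList (Bn n)) ⟩
    count (inClass b k) (BnWords n)
      ≡⟨ count-↭ (inClass b k) (BnWords↭signedWords n) ⟩
    G b n k ∎
    where
    open ≡-Reasoning
    isTrue : ∀ c → ⌊ c Bool.≟ true ⌋ ≡ c
    isTrue true  = refl
    isTrue false = refl

  D≡G : ∀ n k → D n k ≡ G true n k
  D≡G = filterBn≡G true

  D̃≡G : ∀ n k → D̃ n k ≡ G false n k
  D̃≡G = filterBn≡G false

open Counting using ([_])
open Recurrence using (G; G-recurrence; G-recurrence-zero; G-vanishes; G-zero; G-diagonal)
open Binomial using (absorption)
open Enumeration using (D≡G; D̃≡G)
open import Data.Nat.Combinatorics using (_C_; nCk+nC[k+1]≡[n+1]C[k+1]; k>n⇒nCk≡0)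
open import Data.Integer using (_+_; _-_; _*_; _^_; _/_)
open import Data.Integer.Tactic.RingSolver using (solve-∀)
open ≡-Reasoning

sign : ℕ → ℤ
sign k = (- + 1) ^ k

cast-recurrence : ∀ p q r s x y z w →
  + ((p ℕ.* x ℕ.+ q ℕ.* y) ℕ.+ (r ℕ.* z ℕ.+ s ℕ.* w)) ≡ (+ p * + x + + q * + y) + (+ r * + z + + s * + w)
cast-recurrence p q r s x y z w =
  trans (ℤP.pos-+ (p ℕ.* x ℕ.+ q ℕ.* y) (r ℕ.* z ℕ.+ s ℕ.* w))
    (cong₂ _+_ (trans (ℤP.pos-+ (p ℕ.* x) (q ℕ.* y)) (cong₂ _+_ (ℤP.pos-* p x) (ℤP.pos-* q y)))
               (trans (ℤP.pos-+ (r ℕ.* z) (s ℕ.* w)) (cong₂ _+_ (ℤP.pos-* r z) (ℤP.pos-* s w))))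

G-recurrenceℤ : ∀ b m j → j ≤ m → + G b (suc m) (suc j) ≡
  ((+ 1 + + suc j) * + G b m (suc j) + + (m ∸ j) * + G b m j)
  + (+ suc j * + G (not b) m (suc j) + (+ 1 + + (m ∸ j)) * + G (not b) m j)
G-recurrenceℤ b m j j≤m rewrite G-recurrence b m j | ℕP.+-∸-assoc 1 j≤m =
  cast-recurrence (suc (suc j)) (m ∸ j) (suc j) (suc (m ∸ j))
                  (G b m (suc j)) (G b m j) (G (not b) m (suc j)) (G (not b) m j)

-- A count that vanishes for trivial reasons: more descents than letters.
difference-vanishing : ∀ m k → m < k → + G true m k - + G false m k ≡ sign k * + (m C k)
difference-vanishing m k m<k rewrite G-vanishes true m k m<k | G-vanishes false m k m<k | k>n⇒nCk≡0 m<k =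
  sym (ℤP.*-zeroʳ (sign k))

difference : ∀ m k → + G true m k - + G false m k ≡ sign k * + (m C k)
difference zero    zero    = refl
difference zero    (suc k) = difference-vanishing zero (suc k) (s≤s z≤n)
difference (suc m) zero    rewrite G-recurrence-zero true m | G-recurrence-zero false m = difference m zero
difference (suc m) (suc k) with ℕP.≤-<-connex k m
... | inj₂ m<k = difference-vanishing (suc m) (suc k) (s≤s m<k)
... | inj₁ k≤m = begin
  + G true (suc m) (suc k) - + G false (suc m) (suc k)
    ≡⟨ cong₂ _-_ (G-recurrenceℤ true m k k≤m) (G-recurrenceℤ false m k k≤m) ⟩
  (((+ 1 + K) * D₁ + a * D₀) + (K * T₁ + (+ 1 + a) * T₀)) - (((+ 1 + K) * T₁ + a * T₀) + (K * D₁ + (+ 1 + a) * D₀))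
    ≡⟨ cancel K a D₁ D₀ T₁ T₀ ⟩
  (D₁ - T₁) - (D₀ - T₀)
    ≡⟨ cong₂ _-_ (difference m (suc k)) (difference m k) ⟩
  (- + 1 * sign k) * + (m C suc k) - sign k * + (m C k)
    ≡⟨ factor (sign k) (+ (m C k)) (+ (m C suc k)) ⟩
  sign (suc k) * (+ (m C k) + + (m C suc k))
    ≡⟨ cong (sign (suc k) *_) (trans (sym (ℤP.pos-+ (m C k) (m C suc k))) (cong +_ (nCk+nC[k+1]≡[n+1]C[k+1] m k))) ⟩
  sign (suc k) * + (suc m C suc k) ∎
  where
  K a D₁ D₀ T₁ T₀ : ℤ
  K = + suc k
  a = + (m ∸ k)
  D₁ = + G true m (suc k)
  D₀ = + G true m k
  T₁ = + G false m (suc k)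
  T₀ = + G false m k
  cancel : ∀ K a D₁ D₀ T₁ T₀ →
    (((+ 1 + K) * D₁ + a * D₀) + (K * T₁ + (+ 1 + a) * T₀)) - (((+ 1 + K) * T₁ + a * T₀) + (K * D₁ + (+ 1 + a) * D₀))
    ≡ (D₁ - T₁) - (D₀ - T₀)
  cancel = solve-∀
  factor : ∀ s c₀ c₁ → (- + 1 * s) * c₁ - s * c₀ ≡ (- + 1 * s) * (c₀ + c₁)
  factor = solve-∀

odd-from-even : ∀ m k → + G false m k ≡ + G true m k - sign k * + (m C k)
odd-from-even m k = trans (identity (+ G true m k) (+ G false m k)) (cong (_-_ (+ G true m k)) (difference m k))
  where identity : ∀ x y → y ≡ x - (x - y)
        identity = solve-∀

even-from-odd : ∀ m k → + G true m k ≡ + G false m k + sign k * + (m C k)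
even-from-odd m k = trans (identity (+ G true m k) (+ G false m k)) (cong (_+_ (+ G false m k)) (difference m k))
  where identity : ∀ x y → x ≡ y + (x - y)
        identity = solve-∀

absorptionℤ : ∀ m j → + suc j * + (m C suc j) ≡ + (m ∸ j) * + (m C j)
absorptionℤ m j = trans (sym (ℤP.pos-* (suc j) (m C suc j))) (trans (cong +_ (absorption m j)) (ℤP.pos-* (m ∸ j) (m C j)))

drop-null : ∀ X s d → d ≡ + 0 → X + s * d ≡ X
drop-null X s d refl = trans (cong (_+_ X) (ℤP.*-zeroʳ s)) (ℤP.+-identityʳ X)

-- The algebra of the recurrences: in the recurrence of one class, replace the
-- other class using the difference (the letter s stands for (-1)^j), and
-- absorb the binomials using K C(m,j+1) = a C(m,j).
absorbed : ∀ K a C₁ C₀ → K * C₁ ≡ a * C₀ → K * C₁ - a * C₀ ≡ + 0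
absorbed K a C₁ C₀ e = trans (cong (_- a * C₀) e) (ℤP.+-inverseʳ (a * C₀))

eliminate-odd : ∀ K a X₁ X₀ s C₁ C₀ → K * C₁ ≡ a * C₀ →
  ((+ 1 + K) * X₁ + a * X₀) + (K * (X₁ - (- + 1 * s) * C₁) + (+ 1 + a) * (X₀ - s * C₀))
  ≡ (+ 2 * K + + 1) * X₁ + (+ 2 * a + + 1) * X₀ + C₀ * (- + 1 * s)
eliminate-odd K a X₁ X₀ s C₁ C₀ e =
  trans (identity K a X₁ X₀ s C₁ C₀) (drop-null _ s _ (absorbed K a C₁ C₀ e))
  where
  identity : ∀ K a X₁ X₀ s C₁ C₀ →
    ((+ 1 + K) * X₁ + a * X₀) + (K * (X₁ - (- + 1 * s) * C₁) + (+ 1 + a) * (X₀ - s * C₀))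
    ≡ ((+ 2 * K + + 1) * X₁ + (+ 2 * a + + 1) * X₀ + C₀ * (- + 1 * s)) + s * (K * C₁ - a * C₀)
  identity = solve-∀

eliminate-even : ∀ K a X₁ X₀ s C₁ C₀ → K * C₁ ≡ a * C₀ →
  ((+ 1 + K) * X₁ + a * X₀) + (K * (X₁ + (- + 1 * s) * C₁) + (+ 1 + a) * (X₀ + s * C₀))
  ≡ (+ 2 * K + + 1) * X₁ + (+ 2 * a + + 1) * X₀ - C₀ * (- + 1 * s)
eliminate-even K a X₁ X₀ s C₁ C₀ e =
  trans (identity K a X₁ X₀ s C₁ C₀) (drop-null _ (- s) _ (absorbed K a C₁ C₀ e))
  where
  identity : ∀ K a X₁ X₀ s C₁ C₀ →
    ((+ 1 + K) * X₁ + a * X₀) + (K * (X₁ + (- + 1 * s) * C₁) + (+ 1 + a) * (X₀ + s * C₀))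
    ≡ ((+ 2 * K + + 1) * X₁ + (+ 2 * a + + 1) * X₀ - C₀ * (- + 1 * s)) + (- s) * (K * C₁ - a * C₀)
  identity = solve-∀

coefficient : ∀ x → + (2 ℕ.* x ℕ.+ 1) ≡ + 2 * + x + + 1
coefficient x = trans (ℤP.pos-+ (2 ℕ.* x) 1) (cong (_+ + 1) (ℤP.pos-* 2 x))

coefficient-difference : ∀ m j → + (2 ℕ.* suc m ∸ 2 ℕ.* suc j ℕ.+ 1) ≡ + 2 * + (m ∸ j) + + 1
coefficient-difference m j =
  trans (cong (λ t → + (t ℕ.+ 1)) (sym (ℕP.*-distribˡ-∸ 2 (suc m) (suc j)))) (coefficient (m ∸ j))

G-true-recurrence : ∀ m j → j ≤ m →
  + G true (suc m) (suc j) ≡ + (2 ℕ.* suc j ℕ.+ 1) * + G true m (suc j)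
                             + + (2 ℕ.* suc m ∸ 2 ℕ.* suc j ℕ.+ 1) * + G true m j
                             + + (m C j) * sign (suc j)
G-true-recurrence m j j≤m = begin
  + G true (suc m) (suc j)
    ≡⟨ G-recurrenceℤ true m j j≤m ⟩
  ((+ 1 + K) * X₁ + a * X₀) + (K * + G false m (suc j) + (+ 1 + a) * + G false m j)
    ≡⟨ cong₂ (λ y₁ y₀ → ((+ 1 + K) * X₁ + a * X₀) + (K * y₁ + (+ 1 + a) * y₀))
             (odd-from-even m (suc j)) (odd-from-even m j) ⟩
  ((+ 1 + K) * X₁ + a * X₀) + (K * (X₁ - sign (suc j) * C₁) + (+ 1 + a) * (X₀ - sign j * C₀))
    ≡⟨ eliminate-odd K a X₁ X₀ (sign j) C₁ C₀ (absorptionℤ m j) ⟩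
  (+ 2 * K + + 1) * X₁ + (+ 2 * a + + 1) * X₀ + C₀ * sign (suc j)
    ≡⟨ cong₂ (λ p q → p * X₁ + q * X₀ + C₀ * sign (suc j)) (sym (coefficient (suc j))) (sym (coefficient-difference m j)) ⟩
  + (2 ℕ.* suc j ℕ.+ 1) * X₁ + + (2 ℕ.* suc m ∸ 2 ℕ.* suc j ℕ.+ 1) * X₀ + C₀ * sign (suc j) ∎
  where
  K a X₁ X₀ C₁ C₀ : ℤ
  K = + suc j
  a = + (m ∸ j)
  X₁ = + G true m (suc j)
  X₀ = + G true m j
  C₁ = + (m C suc j)
  C₀ = + (m C j)

G-false-recurrence : ∀ m j → j ≤ m →
  + G false (suc m) (suc j) ≡ + (2 ℕ.* suc j ℕ.+ 1) * + G false m (suc j)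
                              + + (2 ℕ.* suc m ∸ 2 ℕ.* suc j ℕ.+ 1) * + G false m j
                              - + (m C j) * sign (suc j)
G-false-recurrence m j j≤m = begin
  + G false (suc m) (suc j)
    ≡⟨ G-recurrenceℤ false m j j≤m ⟩
  ((+ 1 + K) * X₁ + a * X₀) + (K * + G true m (suc j) + (+ 1 + a) * + G true m j)
    ≡⟨ cong₂ (λ y₁ y₀ → ((+ 1 + K) * X₁ + a * X₀) + (K * y₁ + (+ 1 + a) * y₀))
             (even-from-odd m (suc j)) (even-from-odd m j) ⟩
  ((+ 1 + K) * X₁ + a * X₀) + (K * (X₁ + sign (suc j) * C₁) + (+ 1 + a) * (X₀ + sign j * C₀))
    ≡⟨ eliminate-even K a X₁ X₀ (sign j) C₁ C₀ (absorptionℤ m j) ⟩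
  (+ 2 * K + + 1) * X₁ + (+ 2 * a + + 1) * X₀ - C₀ * sign (suc j)
    ≡⟨ cong₂ (λ p q → p * X₁ + q * X₀ - C₀ * sign (suc j)) (sym (coefficient (suc j))) (sym (coefficient-difference m j)) ⟩
  + (2 ℕ.* suc j ℕ.+ 1) * X₁ + + (2 ℕ.* suc m ∸ 2 ℕ.* suc j ℕ.+ 1) * X₀ - C₀ * sign (suc j) ∎
  where
  K a X₁ X₀ C₁ C₀ : ℤ
  K = + suc j
  a = + (m ∸ j)
  X₁ = + G false m (suc j)
  X₀ = + G false m j
  C₁ = + (m C suc j)
  C₀ = + (m C j)

sign-parity : ∀ n → sign n ≡ (if isEven n then + 1 else - + 1)
sign-parity zero          = refl
sign-parity (suc zero)    = refl
sign-parity (suc (suc n)) = trans (double-negation (sign n)) (sign-parity n)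
  where double-negation : ∀ x → - + 1 * (- + 1 * x) ≡ x
        double-negation = solve-∀

even-indicator : ∀ n → + [ isEven n ] ≡ (+ 1 + sign n) / + 2
even-indicator n rewrite sign-parity n with isEven n
... | true  = refl
... | false = refl

odd-indicator : ∀ n → + [ not (isEven n) ] ≡ (+ 1 - sign n) / + 2
odd-indicator n rewrite sign-parity n with isEven n
... | true  = refl
... | false = refl

D-recurrence : ∀ n k → 0 < k → k < n →
  + D n k ≡ + (2 ℕ.* k ℕ.+ 1) * + D (n ∸ 1) k
            + + (2 ℕ.* n ∸ 2 ℕ.* k ℕ.+ 1) * + D (n ∸ 1) (k ∸ 1)
            + + ((n ∸ 1) C (k ∸ 1)) * (- + 1) ^ k
D-recurrence (suc m) (suc j) _ (s≤s j<m)
  rewrite D≡G (suc m) (suc j) | D≡G m (suc j) | D≡G m j = G-true-recurrence m j (ℕP.<⇒≤ j<m)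

D̃-recurrence : ∀ n k → 0 < k → k < n →
  + D̃ n k ≡ + (2 ℕ.* k ℕ.+ 1) * + D̃ (n ∸ 1) k
             + + (2 ℕ.* n ∸ 2 ℕ.* k ℕ.+ 1) * + D̃ (n ∸ 1) (k ∸ 1)
             - + ((n ∸ 1) C (k ∸ 1)) * (- + 1) ^ k
D̃-recurrence (suc m) (suc j) _ (s≤s j<m)
  rewrite D̃≡G (suc m) (suc j) | D̃≡G m (suc j) | D̃≡G m j = G-false-recurrence m j (ℕP.<⇒≤ j<m)

proposition4p5 : (n : ℕ) →
    (D n 0 ≡ 1) ×
    (D̃ n 0 ≡ 0) ×
    (+ D n n ≡ (+ 1 + (- + 1) ^ n) / + 2) ×
    (+ D̃ n n ≡ (+ 1 - (- + 1) ^ n) / + 2) ×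
    ((k : ℕ) → 0 < k → k < n →
      (+ D n k ≡ + (2 ℕ.* k ℕ.+ 1) * + D (n ∸ 1) k
                 + + (2 ℕ.* n ∸ 2 ℕ.* k ℕ.+ 1) * + D (n ∸ 1) (k ∸ 1)
                 + + ((n ∸ 1) C (k ∸ 1)) * (- + 1) ^ k) ×
      (+ D̃ n k ≡ + (2 ℕ.* k ℕ.+ 1) * + D̃ (n ∸ 1) k
                  + + (2 ℕ.* n ∸ 2 ℕ.* k ℕ.+ 1) * + D̃ (n ∸ 1) (k ∸ 1)
                  - + ((n ∸ 1) C (k ∸ 1)) * (- + 1) ^ k))
proposition4p5 n =
  trans (D≡G n 0) (G-zero true n) ,
  trans (D̃≡G n 0) (G-zero false n) ,
  trans (cong +_ (trans (D≡G n n) (G-diagonal true n))) (even-indicator n) ,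
  trans (cong +_ (trans (D̃≡G n n) (G-diagonal false n))) (odd-indicator n) ,
  λ k 0<k k<n → D-recurrence n k 0<k k<n , D̃-recurrence n k 0<k k<n
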